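{- Let $(G_1,G_2,S)$ be a constrained alignment instance with $m_1=2$ and $m_2=1$. Then for every $k\geq 5$, the wheel $W_k$ is not an induced subgraph of the conflict graph $\mathcal{C}$.
   Context: Let $G_1=(V_1,E_1)$ and $G_2=(V_2,E_2)$ be finite simple undirected graphs with $V_1\cap V_2=\emptyset$, and let $S$ be a bipartite graph with parts $V_1,V_2$ in which every vertex of $V_1$ has degree at most $m_1$ and every vertex of $V_2$ has degree at most $m_2$; edges of $S$ are similarity edges. A $c_4$ is a 4-cycle $a-b-c-d-a$ in $G_1\cup G_2\cup S$ with $a,b\in V_1$, $c,d\in V_2$, $ab\in E_1$, $cd\in E_2$, $ad,bc\in E(S)$, regarded as a subgraph. Two distinct $c_4$s conflict if their similarity edges cannot all belong to a common matching of $S$. The conflict graph $\mathcal{C}$ has one vertex per $c_4$ and an edge between each pair of conflicting $c_4$s. The wheel $W_k$ consists of a cycle $C_k$ together with one additional vertex adjacent to all vertices of the cycle. -}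

module Defs where

open import Data.Nat using (ℕ; zero; suc; _≤_)
open import Data.Fin using (Fin; toℕ) renaming (zero to fzero; suc to fsuc)
open import Data.Bool using (Bool; true; false; if_then_else_)
open import Data.List using (map; allFin)
open import Data.Nat.ListAction using (sum)
open import Data.Empty using (⊥)
open import Data.Unit using (⊤)
open import Data.Product using (Σ; _×_; _,_)
open import Data.Sum using (_⊎_)
open import Relation.Binary.PropositionalEquality using (_≡_; _≢_)
open import Relation.Nullary using (¬_)
open import Function.Bundles using (_⇔_)

record SimpleGraph (n : ℕ) : Set where
  field
    adj   : Fin n → Fin n → Bool
    sym   : ∀ u v → adj u v ≡ adj v u
    irrefl : ∀ v → adj v v ≡ false

open SimpleGraph public

BipGraph : ℕ → ℕ → Set
BipGraph n₁ n₂ = Fin n₁ → Fin n₂ → Bool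

deg₁ : ∀ {n₁ n₂} → BipGraph n₁ n₂ → Fin n₁ → ℕ
deg₁ {n₂ = n₂} S a = sum (map (λ c → if S a c then 1 else 0) (allFin n₂))

deg₂ : ∀ {n₁ n₂} → BipGraph n₁ n₂ → Fin n₂ → ℕ
deg₂ {n₁ = n₁} S c = sum (map (λ a → if S a c then 1 else 0) (allFin n₁))

record Instance (m₁ m₂ : ℕ) : Set where
  field
    n₁ n₂ : ℕ
    G₁ : SimpleGraph n₁
    G₂ : SimpleGraph n₂
    S  : BipGraph n₁ n₂
    deg₁≤ : ∀ a → deg₁ S a ≤ m₁
    deg₂≤ : ∀ c → deg₂ S c ≤ m₂

record C4 {m₁ m₂} (I : Instance m₁ m₂) : Set where
  open Instance I
  field
    a b : Fin n₁
    c d : Fin n₂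
    ab∈E₁ : adj G₁ a b ≡ true
    cd∈E₂ : adj G₂ c d ≡ true
    ad∈S  : S a d ≡ true
    bc∈S  : S b c ≡ true

-- Two c4s are the same subgraph iff their edge sets coincide; the only
-- relabelling of a-b-c-d-a preserving the shape (a,b ∈ V₁, ab ∈ E₁, ...)
-- is the reflection (a,b,c,d) ↦ (b,a,d,c).
SameC4 : ∀ {m₁ m₂} {I : Instance m₁ m₂} → C4 I → C4 I → Set
SameC4 x y =
  (C4.a x ≡ C4.a y × C4.b x ≡ C4.b y × C4.c x ≡ C4.c y × C4.d x ≡ C4.d y)
  ⊎ (C4.a x ≡ C4.b y × C4.b x ≡ C4.a y × C4.c x ≡ C4.d y × C4.d x ≡ C4.c y)

IsMatching : ∀ {n₁ n₂} → BipGraph n₁ n₂ → BipGraph n₁ n₂ → Set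
IsMatching S M =
  (∀ a c → M a c ≡ true → S a c ≡ true)
  × (∀ a c c′ → M a c ≡ true → M a c′ ≡ true → c ≡ c′)
  × (∀ a a′ c → M a c ≡ true → M a′ c ≡ true → a ≡ a′)

CommonMatching : ∀ {m₁ m₂} {I : Instance m₁ m₂} → C4 I → C4 I → Set
CommonMatching {I = I} x y =
  Σ (BipGraph (Instance.n₁ I) (Instance.n₂ I)) λ M →
    IsMatching (Instance.S I) M
    × M (C4.a x) (C4.d x) ≡ true × M (C4.b x) (C4.c x) ≡ true
    × M (C4.a y) (C4.d y) ≡ true × M (C4.b y) (C4.c y) ≡ true

Conflict : ∀ {m₁ m₂} {I : Instance m₁ m₂} → C4 I → C4 I → Set
Conflict x y = ¬ SameC4 x y × ¬ CommonMatching x y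

CycleSucc : (k : ℕ) → Fin k → Fin k → Set
CycleSucc k i j = (suc (toℕ i) ≡ toℕ j) ⊎ (suc (toℕ i) ≡ k × toℕ j ≡ 0)

CycleAdj : (k : ℕ) → Fin k → Fin k → Set
CycleAdj k i j = CycleSucc k i j ⊎ CycleSucc k j i

WheelAdj : (k : ℕ) → Fin (suc k) → Fin (suc k) → Set
WheelAdj k fzero    fzero    = ⊥
WheelAdj k fzero    (fsuc j) = ⊤
WheelAdj k (fsuc i) fzero    = ⊤
WheelAdj k (fsuc i) (fsuc j) = CycleAdj k i j

WheelInducedIn : ∀ {m₁ m₂} → ℕ → Instance m₁ m₂ → Set
WheelInducedIn k I =
  Σ (Fin (suc k) → C4 I) λ f →
    (∀ u v → SameC4 (f u) (f v) → u ≡ v)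
    × (∀ u v → u ≢ v → WheelAdj k u v ⇔ Conflict (f u) (f v))

-- Let h be the hub and r₀ … r_{k-1} the rim.  With m₂ = 1 distinct c4s conflict exactly when
-- they use two different similarity edges at a common vertex of V₁, so every rᵢ has an
-- edge at a vertex of h which is not an edge of h.  With m₁ = 2 each similarity edge of h
-- lies in at most one rim c4.  If both edges of h lie in rim c4s u and v, then u ≠ v and
-- some rim c4 agreeing with both (u itself, or one at distance 2 and 3 when u, v are
-- adjacent) cannot conflict with h.  Otherwise four consecutive rim c4s w, x, y, z contain
-- no edge of h; their three clashes then avoid the vertices of h, hence all lie at one
-- vertex, where z agrees with both w and x although these clash.  k ≥ 5 leaves the room.

module Submission where

open import Defs hiding (sym)

open import Data.Bool using (true; false; if_then_else_)
open import Data.Empty using (⊥)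
open import Data.Fin using (Fin; toℕ; punchOut; _≟_) renaming (zero to fzero; suc to fsuc)
open import Data.Fin.Properties
  using (suc-injective; punchIn-punchOut; punchOut-injective; any?; toℕ-fromℕ<; toℕ-injective; toℕ<n)
open import Data.List using (map; tabulate; allFin)
open import Data.List.Properties using (map-tabulate)
open import Data.Nat using (ℕ; zero; suc; _+_; _*_; _≤_; _<_; _<?_; z≤n; s≤s; NonZero; >-nonZero)
import Data.Nat as ℕ
open import Data.Nat.DivMod
  using (_%_; _/_; _mod_; m%n<n; m<n⇒m%n≡m; %-distribˡ-+; m%n%n≡m%n; n%n≡0; m≡m%n+[m/n]*n)
open import Data.Nat.Divisibility using (divides; ∣⇒≤)
open import Data.Nat.ListAction using (sum)
open import Data.Nat.Properties
  using (+-0-commutativeMonoid; ≤-trans; ≤-reflexive; ≤-antisym; m≤m+n; n≤1+n; +-monoʳ-≤; ≤⇒≯; <⇒≱; ≮⇒≥;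
         +-comm; +-suc; +-cancelʳ-≡; module ≤-Reasoning)
open import Algebra.Properties.CommutativeMonoid.Sum +-0-commutativeMonoid
  using () renaming (sum to ∑; sum-remove to ∑-remove)
open import Data.Product using (_×_; _,_; ∃-syntax)
open import Data.Sum using (_⊎_; inj₁; inj₂; [_,_])
open import Data.Unit using (tt)
open import Data.Vec.Functional using (Vector; removeAt)
open import Function using (_∘_; id)
open import Function.Bundles using (_⇔_; Equivalence)
open import Relation.Binary.PropositionalEquality
  using (_≡_; _≢_; refl; sym; trans; cong; cong₂; subst; module ≡-Reasoning)
open import Relation.Nullary using (¬_; Dec; does; yes; no; contradiction)
open import Relation.Nullary.Decidable using (map′; _×-dec_; _⊎-dec_; ¬?; dec-true; decidable-stable)

private
  variable
    n : ℕ

  dec-true⁻¹ : ∀ {A : Set} (a? : Dec A) → does a? ≡ true → A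
  dec-true⁻¹ (yes a) _ = a

sum-tabulate : (g : Vector ℕ n) → sum (tabulate g) ≡ ∑ g
sum-tabulate {zero}  g = refl
sum-tabulate {suc n} g = cong (g fzero +_) (sum-tabulate (g ∘ fsuc))

sum-allFin : (g : Vector ℕ n) → sum (map g (allFin n)) ≡ ∑ g
sum-allFin g = trans (cong sum (map-tabulate id g)) (sum-tabulate g)

lookup≤∑ : (g : Vector ℕ n) (i : Fin n) → g i ≤ ∑ g
lookup≤∑ {suc n} g i = ≤-trans (m≤m+n (g i) _) (≤-reflexive (sym (∑-remove {i = i} g)))

pair≤∑ : (g : Vector ℕ n) {i j : Fin n} → i ≢ j → g i + g j ≤ ∑ g
pair≤∑ {suc n} g {i} {j} i≢j = begin
  g i + g j                              ≡⟨ cong (λ t → g i + g t) (sym (punchIn-punchOut i≢j)) ⟩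
  g i + removeAt g i (punchOut i≢j)      ≤⟨ +-monoʳ-≤ (g i) (lookup≤∑ (removeAt g i) _) ⟩
  g i + ∑ (removeAt g i)                 ≡⟨ ∑-remove g ⟨
  ∑ g                                    ∎
  where open ≤-Reasoning

triple≤∑ : (g : Vector ℕ n) {i j l : Fin n} → i ≢ j → i ≢ l → j ≢ l → g i + (g j + g l) ≤ ∑ g
triple≤∑ {suc n} g {i} {j} {l} i≢j i≢l j≢l = begin
  g i + (g j + g l)
    ≡⟨ cong₂ (λ s t → g i + (g s + g t)) (sym (punchIn-punchOut i≢j)) (sym (punchIn-punchOut i≢l)) ⟩
  g i + (g′ (punchOut i≢j) + g′ (punchOut i≢l))
    ≤⟨ +-monoʳ-≤ (g i) (pair≤∑ g′ (j≢l ∘ punchOut-injective i≢j i≢l)) ⟩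
  g i + ∑ g′
    ≡⟨ ∑-remove g ⟨
  ∑ g
    ∎
  where
    open ≤-Reasoning
    g′ : Vector ℕ n
    g′ = removeAt g i

module _ {n₁ n₂ : ℕ} {S : BipGraph n₁ n₂} where

  private
    counts-one : ∀ {b} → b ≡ true → (if b then 1 else 0) ≡ 1
    counts-one = cong (λ b → if b then 1 else 0)

  deg₂≤1⇒unique-partner : ∀ {p p′ q} → deg₂ S q ≤ 1 → S p q ≡ true → S p′ q ≡ true → p ≡ p′
  deg₂≤1⇒unique-partner {p} {p′} {q} bound Spq Sp′q with p ≟ p′
  ... | yes p≡p′ = p≡p′
  ... | no p≢p′  = contradiction 2≤deg (≤⇒≯ bound)
    where
      open ≤-Reasoning
      g : Vector ℕ n₁
      g a = if S a q then 1 else 0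
      2≤deg : 2 ≤ deg₂ S q
      2≤deg = begin
        2          ≡⟨ cong₂ _+_ (counts-one Spq) (counts-one Sp′q) ⟨
        g p + g p′ ≤⟨ pair≤∑ g p≢p′ ⟩
        ∑ g        ≡⟨ sum-allFin g ⟨
        deg₂ S q   ∎

  deg₁≤2⇒two-partners : ∀ {p q q′ q″} → deg₁ S p ≤ 2 →
                        S p q ≡ true → S p q′ ≡ true → S p q″ ≡ true →
                        q ≡ q′ ⊎ q ≡ q″ ⊎ q′ ≡ q″
  deg₁≤2⇒two-partners {p} {q} {q′} {q″} bound Spq Spq′ Spq″ with q ≟ q′ | q ≟ q″ | q′ ≟ q″
  ... | yes q≡q′ | _        | _          = inj₁ q≡q′
  ... | no _     | yes q≡q″ | _          = inj₂ (inj₁ q≡q″)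
  ... | no _     | no _     | yes q′≡q″  = inj₂ (inj₂ q′≡q″)
  ... | no q≢q′  | no q≢q″  | no q′≢q″   = contradiction 3≤deg (≤⇒≯ bound)
    where
      open ≤-Reasoning
      g : Vector ℕ n₂
      g c = if S p c then 1 else 0
      3≤deg : 3 ≤ deg₁ S p
      3≤deg = begin
        3                   ≡⟨ cong₂ _+_ (counts-one Spq) (cong₂ _+_ (counts-one Spq′) (counts-one Spq″)) ⟨
        g q + (g q′ + g q″) ≤⟨ triple≤∑ g q≢q′ q≢q″ q′≢q″ ⟩
        ∑ g                 ≡⟨ sum-allFin g ⟨
        deg₁ S p            ∎

module _ {m₁ m₂ : ℕ} {I : Instance m₁ m₂} where
  open Instance I
  open C4

  data Uses (x : C4 I) (p : Fin n₁) (q : Fin n₂) : Set where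
    ad-edge : a x ≡ p → d x ≡ q → Uses x p q
    bc-edge : b x ≡ p → c x ≡ q → Uses x p q

  uses? : (x : C4 I) (p : Fin n₁) (q : Fin n₂) → Dec (Uses x p q)
  uses? x p q = map′ from-sum to-sum ((a x ≟ p ×-dec d x ≟ q) ⊎-dec (b x ≟ p ×-dec c x ≟ q))
    where
      from-sum : (a x ≡ p × d x ≡ q) ⊎ (b x ≡ p × c x ≡ q) → Uses x p q
      from-sum (inj₁ (a≡p , d≡q)) = ad-edge a≡p d≡q
      from-sum (inj₂ (b≡p , c≡q)) = bc-edge b≡p c≡q
      to-sum : Uses x p q → (a x ≡ p × d x ≡ q) ⊎ (b x ≡ p × c x ≡ q)
      to-sum (ad-edge a≡p d≡q) = inj₁ (a≡p , d≡q)
      to-sum (bc-edge b≡p c≡q) = inj₂ (b≡p , c≡q)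

  uses⇒S : ∀ {x p q} → Uses x p q → S p q ≡ true
  uses⇒S {x} (ad-edge refl refl) = ad∈S x
  uses⇒S {x} (bc-edge refl refl) = bc∈S x

  a≢b : (x : C4 I) → a x ≢ b x
  a≢b x a≡b = contradiction true≡false λ ()
    where
      open ≡-Reasoning
      true≡false : true ≡ false
      true≡false = begin
        true               ≡⟨ ab∈E₁ x ⟨
        adj G₁ (a x) (b x) ≡⟨ cong (adj G₁ (a x)) a≡b ⟨
        adj G₁ (a x) (a x) ≡⟨ irrefl G₁ (a x) ⟩
        false              ∎

  uses-functional : ∀ {x p q q′} → Uses x p q → Uses x p q′ → q ≡ q′
  uses-functional     (ad-edge refl refl) (ad-edge _ refl)   = refl
  uses-functional {x} (ad-edge refl refl) (bc-edge b≡a _)    = contradiction (sym b≡a) (a≢b x)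
  uses-functional {x} (bc-edge refl refl) (ad-edge a≡b _)    = contradiction a≡b (a≢b x)
  uses-functional     (bc-edge refl refl) (bc-edge _ refl)   = refl

  uses-two-vertices : ∀ {x p₁ p₂ p₃ q₁ q₂ q₃} → Uses x p₁ q₁ → Uses x p₂ q₂ → Uses x p₃ q₃ →
                      p₁ ≡ p₂ ⊎ p₁ ≡ p₃ ⊎ p₂ ≡ p₃
  uses-two-vertices (ad-edge refl _) (ad-edge refl _) _                = inj₁ refl
  uses-two-vertices (bc-edge refl _) (bc-edge refl _) _                = inj₁ refl
  uses-two-vertices (ad-edge refl _) (bc-edge refl _) (ad-edge refl _) = inj₂ (inj₁ refl)
  uses-two-vertices (ad-edge refl _) (bc-edge refl _) (bc-edge refl _) = inj₂ (inj₂ refl)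
  uses-two-vertices (bc-edge refl _) (ad-edge refl _) (ad-edge refl _) = inj₂ (inj₂ refl)
  uses-two-vertices (bc-edge refl _) (ad-edge refl _) (bc-edge refl _) = inj₂ (inj₁ refl)

  private
    ad,bc⇒sameC4 : ∀ {x y} → Uses y (a x) (d x) → Uses y (b x) (c x) → SameC4 x y
    ad,bc⇒sameC4 {x} (ad-edge a≡ _)  (ad-edge a≡′ _) = contradiction (trans (sym a≡) a≡′) (a≢b x)
    ad,bc⇒sameC4     (ad-edge a≡ d≡) (bc-edge b≡ c≡) = inj₁ (sym a≡ , sym b≡ , sym c≡ , sym d≡)
    ad,bc⇒sameC4     (bc-edge b≡ c≡) (ad-edge a≡ d≡) = inj₂ (sym b≡ , sym a≡ , sym d≡ , sym c≡)
    ad,bc⇒sameC4 {x} (bc-edge b≡ _)  (bc-edge b≡′ _) = contradiction (trans (sym b≡) b≡′) (a≢b x)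

  shared-edges⇒sameC4 : ∀ {x y p p′ q q′} → p ≢ p′ →
                        Uses x p q → Uses x p′ q′ → Uses y p q → Uses y p′ q′ → SameC4 x y
  shared-edges⇒sameC4 p≢p′ (ad-edge refl _)    (ad-edge refl _)    _   _   = contradiction refl p≢p′
  shared-edges⇒sameC4 {x} _ (ad-edge refl refl) (bc-edge refl refl) yad ybc = ad,bc⇒sameC4 {x} yad ybc
  shared-edges⇒sameC4 {x} _ (bc-edge refl refl) (ad-edge refl refl) ybc yad = ad,bc⇒sameC4 {x} yad ybc
  shared-edges⇒sameC4 p≢p′ (bc-edge refl _)    (bc-edge refl _)    _   _   = contradiction refl p≢p′

  reflect : C4 I → C4 I
  reflect x = record
    { a = b x ; b = a x ; c = d x ; d = c x
    ; ab∈E₁ = trans (SimpleGraph.sym G₁ (b x) (a x)) (ab∈E₁ x)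
    ; cd∈E₂ = trans (SimpleGraph.sym G₂ (d x) (c x)) (cd∈E₂ x)
    ; ad∈S = bc∈S x
    ; bc∈S = ad∈S x
    }

  uses-reflect : ∀ {x p q} → Uses x p q → Uses (reflect x) p q
  uses-reflect (ad-edge a≡p d≡q) = bc-edge a≡p d≡q
  uses-reflect (bc-edge b≡p c≡q) = ad-edge b≡p c≡q

  -- Only shared V₁-endpoints are compared; for m₂ = 1 this characterises CommonMatching.
  Compatible : C4 I → C4 I → Set
  Compatible x y = ∀ {p q q′} → Uses x p q → Uses y p q′ → q ≡ q′

  Clash : C4 I → C4 I → Set
  Clash x y = ∃[ p ] ∃[ q ] ∃[ q′ ] Uses x p q × Uses y p q′ × q ≢ q′

  clash? : (x y : C4 I) → Dec (Clash x y)
  clash? x y = any? λ p → any? λ q → any? λ q′ → uses? x p q ×-dec uses? y p q′ ×-dec ¬? (q ≟ q′)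

  clash-reflectˡ : ∀ {x y} → Clash x y → Clash (reflect x) y
  clash-reflectˡ (p , q , q′ , xpq , ypq′ , q≢q′) = p , q , q′ , uses-reflect xpq , ypq′ , q≢q′

  compatible-sym : ∀ {x y} → Compatible x y → Compatible y x
  compatible-sym x~y ypq xpq′ = sym (x~y xpq′ ypq)

  compatible-refl : ∀ {x} → Compatible x x
  compatible-refl = uses-functional

  compatible⇒¬clash : ∀ {x y} → Compatible x y → ¬ Clash x y
  compatible⇒¬clash x~y (_ , _ , _ , xpq , ypq′ , q≢q′) = q≢q′ (x~y xpq ypq′)

  ¬clash⇒compatible : ∀ {x y} → ¬ Clash x y → Compatible x y
  ¬clash⇒compatible ¬clash {p} {q} {q′} xpq ypq′ with q ≟ q′
  ... | yes q≡q′ = q≡q′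
  ... | no q≢q′  = contradiction (p , q , q′ , xpq , ypq′ , q≢q′) ¬clash

  commonMatching⇒compatible : ∀ {x y} → CommonMatching x y → Compatible x y
  commonMatching⇒compatible {x} {y} (M , (_ , M-functional , _) , Mx-ad , Mx-bc , My-ad , My-bc) xpq ypq′ =
    M-functional _ _ _ (in-M Mx-ad Mx-bc xpq) (in-M My-ad My-bc ypq′)
    where
      in-M : ∀ {z p q} → M (a z) (d z) ≡ true → M (b z) (c z) ≡ true → Uses z p q → M p q ≡ true
      in-M Mad _ (ad-edge refl refl) = Mad
      in-M _ Mbc (bc-edge refl refl) = Mbc

  ¬conflict⇒compatible : ∀ {x y} → ¬ SameC4 x y → ¬ Conflict x y → Compatible x y
  ¬conflict⇒compatible ¬same ¬conflict = ¬clash⇒compatible λ clash →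
    ¬conflict (¬same , λ cm → compatible⇒¬clash (commonMatching⇒compatible cm) clash)

  -- u contains the edge ad of the hub h; the edge bc of h is the edge ad of reflect h.
  Covers : C4 I → C4 I → Set
  Covers h u = Uses u (a h) (d h)

  Avoids : C4 I → C4 I → Set
  Avoids h u = ¬ Covers h u × ¬ Covers (reflect h) u

  covers-both⇒sameC4 : ∀ {h u : C4 I} → Covers h u → Covers (reflect h) u → SameC4 h u
  covers-both⇒sameC4 {h} u-ad u-bc = shared-edges⇒sameC4 {x = h} (a≢b h) (ad-edge refl refl) (bc-edge refl refl) u-ad u-bc

  clash⇒¬compatible-with-covers : ∀ {h m u v : C4 I} → Clash h m →
                                  Compatible m u → Covers h u → Compatible m v → Covers (reflect h) v → ⊥
  clash⇒¬compatible-with-covers (_ , _ , _ , ad-edge refl refl , mpq′ , q≢q′) m~u u-ad _ _ = q≢q′ (sym (m~u mpq′ u-ad))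
  clash⇒¬compatible-with-covers (_ , _ , _ , bc-edge refl refl , mpq′ , q≢q′) _ _ m~v v-bc = q≢q′ (sym (m~v mpq′ v-bc))

  covering-clash-at-b : ∀ {h x : C4 I} → Clash h x → Covers h x → ∃[ q ] Uses x (b h) q × q ≢ c h
  covering-clash-at-b (_ , _ , _ , ad-edge refl refl , xpq′ , q≢q′) x-ad = contradiction (uses-functional x-ad xpq′) q≢q′
  covering-clash-at-b (_ , _ , q′ , bc-edge refl refl , xpq′ , q≢q′) _    = q′ , xpq′ , q≢q′ ∘ sym

  off-hub-vertices-equal :
    ∀ {h x : C4 I} {p₁ p₂ q₁ q₂} → Clash h x → Uses x p₁ q₁ → Uses x p₂ q₂ →
    (∀ {r} → ¬ Uses h p₁ r) → (∀ {r} → ¬ Uses h p₂ r) → p₁ ≡ p₂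
  off-hub-vertices-equal (_ , _ , _ , hpq , xpq′ , _) xp₁ xp₂ off₁ off₂
    with uses-two-vertices xp₁ xp₂ xpq′
  ... | inj₁ p₁≡p₂        = p₁≡p₂
  ... | inj₂ (inj₁ refl)  = contradiction hpq off₁
  ... | inj₂ (inj₂ refl)  = contradiction hpq off₂

module _ {m₁ : ℕ} {I : Instance m₁ 1} where
  open Instance I
  open C4

  compatible⇒commonMatching : ∀ {x y : C4 I} → Compatible x y → CommonMatching x y
  compatible⇒commonMatching {x} {y} x~y =
    M , (M⊆S , M-functional , M-injective) ,
    in-M (inj₁ (ad-edge refl refl)) , in-M (inj₁ (bc-edge refl refl)) ,
    in-M (inj₂ (ad-edge refl refl)) , in-M (inj₂ (bc-edge refl refl))
    where
      edge? : ∀ p q → Dec (Uses x p q ⊎ Uses y p q)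
      edge? p q = uses? x p q ⊎-dec uses? y p q
      M : BipGraph n₁ n₂
      M p q = does (edge? p q)
      in-M : ∀ {p q} → Uses x p q ⊎ Uses y p q → M p q ≡ true
      in-M = dec-true (edge? _ _)
      edge-of-M : ∀ {p q} → M p q ≡ true → Uses x p q ⊎ Uses y p q
      edge-of-M = dec-true⁻¹ (edge? _ _)
      M⊆S : ∀ p q → M p q ≡ true → S p q ≡ true
      M⊆S p q Mpq = [ uses⇒S , uses⇒S ] (edge-of-M Mpq)
      functional : ∀ {p q q′} → Uses x p q ⊎ Uses y p q → Uses x p q′ ⊎ Uses y p q′ → q ≡ q′
      functional (inj₁ xpq) (inj₁ xpq′) = uses-functional xpq xpq′
      functional (inj₁ xpq) (inj₂ ypq′) = x~y xpq ypq′
      functional (inj₂ ypq) (inj₁ xpq′) = sym (x~y xpq′ ypq)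
      functional (inj₂ ypq) (inj₂ ypq′) = uses-functional ypq ypq′
      M-functional : ∀ p q q′ → M p q ≡ true → M p q′ ≡ true → q ≡ q′
      M-functional _ _ _ Mpq Mpq′ = functional (edge-of-M Mpq) (edge-of-M Mpq′)
      M-injective : ∀ p p′ q → M p q ≡ true → M p′ q ≡ true → p ≡ p′
      M-injective p p′ q Mpq Mp′q = deg₂≤1⇒unique-partner {S = S} (deg₂≤ q) (M⊆S p q Mpq) (M⊆S p′ q Mp′q)

  conflict⇒clash : ∀ {x y : C4 I} → Conflict x y → Clash x y
  conflict⇒clash {x} {y} (_ , ¬cm) =
    decidable-stable (clash? x y) λ ¬clash → ¬cm (compatible⇒commonMatching (¬clash⇒compatible ¬clash))

module _ {m₂ : ℕ} {I : Instance 2 m₂} where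
  open Instance I
  open C4

  uncovered⇒no-clash-at-a : ∀ {h u v : C4 I} {q q′} → ¬ Covers h u → ¬ Covers h v →
                            Uses u (a h) q → Uses v (a h) q′ → q ≢ q′ → ⊥
  uncovered⇒no-clash-at-a {h} ¬u-ad ¬v-ad uaq vaq′ q≢q′
    with deg₁≤2⇒two-partners {S = S} (deg₁≤ (a h)) (ad∈S h) (uses⇒S uaq) (uses⇒S vaq′)
  ... | inj₁ refl        = ¬u-ad uaq
  ... | inj₂ (inj₁ refl) = ¬v-ad vaq′
  ... | inj₂ (inj₂ q≡q′) = q≢q′ q≡q′

  avoiding-clash-off-hub : ∀ {h u v : C4 I} {p q q′ r} → Avoids h u → Avoids h v →
                           Uses u p q → Uses v p q′ → q ≢ q′ → ¬ Uses h p r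
  avoiding-clash-off-hub {h} (¬u-ad , _) (¬v-ad , _) upq vpq′ q≢q′ (ad-edge refl _) =
    uncovered⇒no-clash-at-a {h = h} ¬u-ad ¬v-ad upq vpq′ q≢q′
  avoiding-clash-off-hub {h} (_ , ¬u-bc) (_ , ¬v-bc) upq vpq′ q≢q′ (bc-edge refl _) =
    uncovered⇒no-clash-at-a {h = reflect h} ¬u-bc ¬v-bc upq vpq′ q≢q′

  covers-unique : ∀ {h u v : C4 I} → Clash h u → Clash h v → Covers h u → Covers h v → SameC4 u v
  covers-unique {h} h#u h#v u-ad v-ad
    with covering-clash-at-b h#u u-ad | covering-clash-at-b h#v v-ad
  ... | q , ubq , q≢c | q′ , vbq′ , q′≢c
    with deg₁≤2⇒two-partners {S = S} (deg₁≤ (b h)) (bc∈S h) (uses⇒S ubq) (uses⇒S vbq′)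
  ... | inj₁ c≡q         = contradiction (sym c≡q) q≢c
  ... | inj₂ (inj₁ c≡q′) = contradiction (sym c≡q′) q′≢c
  ... | inj₂ (inj₂ refl) = shared-edges⇒sameC4 (a≢b h) u-ad ubq v-ad vbq′

  -- The three clashes avoid the vertices of h, and x, y each have only one vertex outside h,
  -- so all three clashes sit at the same vertex.
  no-avoiding-path : ∀ {h w x y z : C4 I} → Clash h x → Clash h y →
                     Avoids h w → Avoids h x → Avoids h y → Avoids h z →
                     Clash w x → Clash x y → Clash y z → Compatible x z → Compatible w z → ⊥
  no-avoiding-path h#x h#y w-av x-av y-av z-av
    (_ , _ , _ , wp₁ , xp₁ , ≢₁) (_ , _ , _ , xp₂ , yp₂ , ≢₂) (_ , _ , _ , yp₃ , zp₃ , ≢₃) x~z w~z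
    with off-hub-vertices-equal h#x xp₁ xp₂
           (avoiding-clash-off-hub w-av x-av wp₁ xp₁ ≢₁) (avoiding-clash-off-hub x-av y-av xp₂ yp₂ ≢₂)
  ... | refl
    with off-hub-vertices-equal h#y yp₂ yp₃
           (avoiding-clash-off-hub x-av y-av xp₂ yp₂ ≢₂) (avoiding-clash-off-hub y-av z-av yp₃ zp₃ ≢₃)
  ... | refl = ≢₁ (trans (w~z wp₁ zp₃) (sym (x~z xp₁ zp₃)))

cycleSucc? : ∀ k (i j : Fin k) → Dec (CycleSucc k i j)
cycleSucc? k i j = (suc (toℕ i) ℕ.≟ toℕ j) ⊎-dec ((suc (toℕ i) ℕ.≟ k) ×-dec (toℕ j ℕ.≟ 0))

cycleAdj? : ∀ k (i j : Fin k) → Dec (CycleAdj k i j)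
cycleAdj? k i j = cycleSucc? k i j ⊎-dec cycleSucc? k j i

module _ {k : ℕ} {{_ : NonZero k}} where

  toℕ-mod : ∀ m → toℕ (m mod k) ≡ m % k
  toℕ-mod m = toℕ-fromℕ< (m%n<n m k)

  mod-toℕ : (i : Fin k) → toℕ i mod k ≡ i
  mod-toℕ i = toℕ-injective (trans (toℕ-mod (toℕ i)) (m<n⇒m%n≡m (toℕ<n i)))

  +-%-reduce : ∀ e m → (e + m) % k ≡ (e + m % k) % k
  +-%-reduce e m = begin
    (e + m) % k             ≡⟨ %-distribˡ-+ e m k ⟩
    (e % k + m % k) % k     ≡⟨ cong (λ r → (e % k + r) % k) (m%n%n≡m%n m k) ⟨
    (e % k + m % k % k) % k ≡⟨ %-distribˡ-+ e (m % k) k ⟨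
    (e + m % k) % k         ∎
    where open ≡-Reasoning

  suc-toℕ-mod : ∀ m → suc (toℕ (m mod k)) mod k ≡ suc m mod k
  suc-toℕ-mod m = toℕ-injective (begin
    toℕ (suc (toℕ (m mod k)) mod k) ≡⟨ toℕ-mod _ ⟩
    suc (toℕ (m mod k)) % k         ≡⟨ cong (λ r → suc r % k) (toℕ-mod m) ⟩
    suc (m % k) % k                 ≡⟨ +-%-reduce 1 m ⟨
    suc m % k                       ≡⟨ toℕ-mod (suc m) ⟨
    toℕ (suc m mod k)               ∎)
    where open ≡-Reasoning

  cycleSucc-next : (i : Fin k) → CycleSucc k i (suc (toℕ i) mod k)
  cycleSucc-next i with suc (toℕ i) <? k
  ... | yes 1+i<k = inj₁ (sym (trans (toℕ-mod _) (m<n⇒m%n≡m 1+i<k)))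
  ... | no  1+i≮k = inj₂ (1+i≡k , trans (toℕ-mod _) (trans (cong (_% k) 1+i≡k) (n%n≡0 k)))
    where
      1+i≡k : suc (toℕ i) ≡ k
      1+i≡k = ≤-antisym (toℕ<n i) (≮⇒≥ 1+i≮k)

  cycleSucc-mod : ∀ m → CycleSucc k (m mod k) (suc m mod k)
  cycleSucc-mod m = subst (CycleSucc k (m mod k)) (suc-toℕ-mod m) (cycleSucc-next (m mod k))

  cycleSucc⇒≡next : ∀ {i j : Fin k} → CycleSucc k i j → j ≡ suc (toℕ i) mod k
  cycleSucc⇒≡next {i} {j} (inj₁ 1+i≡j) =
    toℕ-injective (sym (trans (toℕ-mod _) (trans (cong (_% k) 1+i≡j) (m<n⇒m%n≡m (toℕ<n j)))))
  cycleSucc⇒≡next {i} {j} (inj₂ (1+i≡k , j≡0)) =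
    toℕ-injective (trans j≡0 (sym (trans (toℕ-mod _) (trans (cong (_% k) 1+i≡k) (n%n≡0 k)))))

  -- r ≡ (e + r) % k forces k ∣ e.
  %-shift-≢ : ∀ r {e} → 0 < e → e < k → r ≢ (e + r) % k
  %-shift-≢ r {e} 0<e e<k r≡ = <⇒≱ e<k (∣⇒≤ {{>-nonZero 0<e}} (divides ((e + r) / k) e≡))
    where
      open ≡-Reasoning
      e≡ : e ≡ (e + r) / k * k
      e≡ = +-cancelʳ-≡ r e _ (begin
        e + r                         ≡⟨ m≡m%n+[m/n]*n (e + r) k ⟩
        (e + r) % k + (e + r) / k * k ≡⟨ cong (_+ (e + r) / k * k) r≡ ⟨
        r + (e + r) / k * k           ≡⟨ +-comm r _ ⟩
        (e + r) / k * k + r           ∎)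

  mod-shift-≢ : ∀ m {e} → 0 < e → e < k → m mod k ≢ (e + m) mod k
  mod-shift-≢ m {e} 0<e e<k m≡ = %-shift-≢ (m % k) 0<e e<k (begin
    m % k               ≡⟨ toℕ-mod m ⟨
    toℕ (m mod k)       ≡⟨ cong toℕ m≡ ⟩
    toℕ ((e + m) mod k) ≡⟨ toℕ-mod (e + m) ⟩
    (e + m) % k         ≡⟨ +-%-reduce e m ⟩
    (e + m % k) % k     ∎)
    where open ≡-Reasoning

  mod-shift-nonadjacent : ∀ m {e} → 2 ≤ e → 2 + e ≤ k → ¬ CycleAdj k (m mod k) ((e + m) mod k)
  mod-shift-nonadjacent m {suc e} (s≤s 1≤e) 3+e≤k (inj₁ forward) =
    mod-shift-≢ (suc m) 1≤e (≤-trans (n≤1+n _) (≤-trans (n≤1+n _) 3+e≤k)) (begin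
      suc m mod k                ≡⟨ suc-toℕ-mod m ⟨
      suc (toℕ (m mod k)) mod k  ≡⟨ cycleSucc⇒≡next forward ⟨
      (suc e + m) mod k          ≡⟨ cong (_mod k) (+-suc e m) ⟨
      (e + suc m) mod k          ∎)
    where open ≡-Reasoning
  mod-shift-nonadjacent m {e} _ 2+e≤k (inj₂ backward) =
    mod-shift-≢ m (s≤s z≤n) 2+e≤k (trans (cycleSucc⇒≡next backward) (suc-toℕ-mod (e + m)))

module InducedWheel (I : Instance 2 1) {k : ℕ} {{_ : NonZero k}} (5≤k : 5 ≤ k)
  (f : Fin (suc k) → C4 I)
  (f-injective : ∀ u v → SameC4 (f u) (f v) → u ≡ v)
  (f-induces : ∀ u v → u ≢ v → WheelAdj k u v ⇔ Conflict (f u) (f v)) where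
  open C4

  hub : C4 I
  hub = f fzero

  rim : Fin k → C4 I
  rim i = f (fsuc i)

  at : ℕ → C4 I
  at m = rim (m mod k)

  rim≡at : ∀ i → rim i ≡ at (toℕ i)
  rim≡at i = cong rim (sym (mod-toℕ i))

  hub-clash : ∀ i → Clash hub (rim i)
  hub-clash i = conflict⇒clash (Equivalence.to (f-induces fzero (fsuc i) λ ()) tt)

  rim-injective : ∀ {i j} → SameC4 (rim i) (rim j) → i ≡ j
  rim-injective same = suc-injective (f-injective _ _ same)

  rim-clash : ∀ {i j} → i ≢ j → CycleAdj k i j → Clash (rim i) (rim j)
  rim-clash i≢j adj = conflict⇒clash (Equivalence.to (f-induces _ _ (i≢j ∘ suc-injective)) adj)

  rim-compatible : ∀ {i j} → i ≢ j → ¬ CycleAdj k i j → Compatible (rim i) (rim j)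
  rim-compatible i≢j ¬adj = ¬conflict⇒compatible (i≢j ∘ rim-injective)
    (¬adj ∘ Equivalence.from (f-induces _ _ (i≢j ∘ suc-injective)))

  at-clash : ∀ m → Clash (at m) (at (suc m))
  at-clash m = rim-clash (mod-shift-≢ m (s≤s z≤n) (≤-trans (s≤s (s≤s z≤n)) 5≤k)) (inj₁ (cycleSucc-mod m))

  at-compatible : ∀ m {e} → 2 ≤ e → 2 + e ≤ k → Compatible (at m) (at (e + m))
  at-compatible m 2≤e 2+e≤k =
    rim-compatible (mod-shift-≢ m (≤-trans (s≤s z≤n) 2≤e) (≤-trans (n≤1+n _) 2+e≤k)) (mod-shift-nonadjacent m 2≤e 2+e≤k)

  no-avoiding-window : ∀ h m → (∀ i → Clash h (rim i)) → (∀ {t} → t ≤ 3 → Avoids h (at (t + m))) → ⊥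
  no-avoiding-window h m h-clash avoids =
    no-avoiding-path (h-clash _) (h-clash _)
      (avoids z≤n) (avoids (s≤s z≤n)) (avoids (s≤s (s≤s z≤n))) (avoids (s≤s (s≤s (s≤s z≤n))))
      (at-clash m) (at-clash (1 + m)) (at-clash (2 + m))
      (at-compatible (1 + m) (s≤s (s≤s z≤n)) (≤-trans (n≤1+n 4) 5≤k)) (at-compatible m (s≤s (s≤s z≤n)) 5≤k)

  consecutive-covers⇒⊥ : ∀ h → (∀ i → Clash h (rim i)) → ∀ n →
                         Covers h (at n) → Covers (reflect h) (at (suc n)) → ⊥
  consecutive-covers⇒⊥ h h-clash n n-ad 1+n-bc =
    clash⇒¬compatible-with-covers (h-clash ((3 + n) mod k))
      (compatible-sym (at-compatible n (s≤s (s≤s z≤n)) 5≤k)) n-ad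
      (compatible-sym (at-compatible (suc n) (s≤s (s≤s z≤n)) (≤-trans (n≤1+n 4) 5≤k))) 1+n-bc

  both-covers⇒⊥ : ∀ {i j} → Covers hub (rim i) → Covers (reflect hub) (rim j) → ⊥
  both-covers⇒⊥ {i} {j} i-ad j-bc with i ≟ j
  ... | yes refl = fzero≢fsuc (f-injective fzero (fsuc i) (covers-both⇒sameC4 {h = hub} i-ad j-bc))
    where
      fzero≢fsuc : fzero ≢ fsuc i
      fzero≢fsuc ()
  ... | no i≢j with cycleAdj? k i j
  ... | no ¬adj = clash⇒¬compatible-with-covers (hub-clash i) compatible-refl i-ad (rim-compatible i≢j ¬adj) j-bc
  ... | yes (inj₁ i→j) = consecutive-covers⇒⊥ hub hub-clash (toℕ i)
                           (subst (Covers hub) (rim≡at i) i-ad)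
                           (subst (Covers (reflect hub) ∘ rim) (cycleSucc⇒≡next i→j) j-bc)
  ... | yes (inj₂ j→i) = consecutive-covers⇒⊥ (reflect hub) (clash-reflectˡ ∘ hub-clash) (toℕ j)
                           (subst (Covers (reflect hub)) (rim≡at j) j-bc)
                           (subst (Covers hub ∘ rim) (cycleSucc⇒≡next j→i) i-ad)

  single-cover⇒⊥ : ∀ h {i} → (∀ j → Clash h (rim j)) → Covers h (rim i) → (∀ j → ¬ Covers (reflect h) (rim j)) → ⊥
  single-cover⇒⊥ h {i} h-clash i-ad ¬bc = no-avoiding-window h (suc (toℕ i)) h-clash avoids
    where
      avoids : ∀ {t} → t ≤ 3 → Avoids h (at (t + suc (toℕ i)))
      avoids {t} t≤3 = (λ t-ad → mod-shift-≢ (toℕ i) (s≤s z≤n) (≤-trans (s≤s (s≤s t≤3)) 5≤k) (begin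
          toℕ i mod k             ≡⟨ mod-toℕ i ⟩
          i                       ≡⟨ rim-injective (covers-unique (h-clash i) (h-clash _) i-ad t-ad) ⟩
          (t + suc (toℕ i)) mod k ≡⟨ cong (_mod k) (+-suc t (toℕ i)) ⟩
          (suc t + toℕ i) mod k   ∎))
        , ¬bc _
        where open ≡-Reasoning

  absurd : ⊥
  absurd with any? (λ i → uses? (rim i) (a hub) (d hub)) | any? (λ j → uses? (rim j) (b hub) (c hub))
  ... | yes (i , i-ad) | yes (j , j-bc) = both-covers⇒⊥ i-ad j-bc
  ... | yes (i , i-ad) | no ¬bc         = single-cover⇒⊥ hub hub-clash i-ad (λ j j-bc → ¬bc (j , j-bc))
  ... | no ¬ad         | yes (j , j-bc) =
    single-cover⇒⊥ (reflect hub) (clash-reflectˡ ∘ hub-clash) j-bc (λ i i-ad → ¬ad (i , i-ad))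
  ... | no ¬ad         | no ¬bc         =
    no-avoiding-window hub 0 hub-clash λ _ → (λ ad → ¬ad (_ , ad)) , (λ bc → ¬bc (_ , bc))

theorem6 : (I : Instance 2 1) → (k : ℕ) → 5 ≤ k → ¬ WheelInducedIn k I
theorem6 I k 5≤k (f , f-injective , f-induces) =
  InducedWheel.absurd I {{>-nonZero (≤-trans (s≤s z≤n) 5≤k)}} 5≤k f f-injective f-induces
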